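{- Let $V$ have dimension $k\le\min\{p,q\}$ and let $\mathcal E$ be the set of all endpoint sets of families in the $p\times q$ grid as described in the context. A subset $E\subset[p]^*\cup[q]$ with $\#E=k$ belongs to $\mathcal E$ if and only if $\#E_\ell\le\ell$ for all $1\le\ell\le k$, where $E_\ell=\{i^*\in E:i>p-\ell\}\cup\{j\in E:j>q-\ell\}$.
   Context: $[p]^*=\{1^*,\dots,p^*\}$, $[q]=\{1,\dots,q\}$. The grid $\mathcal P=\{(i^*,j):i\in[p],j\in[q]\}$ has rows $i^*$ from top and columns $j$ from left. A lattice path moves by east steps $(i^*,j)\to(i^*,j+1)$ or south steps $(i^*,j)\to((i+1)^*,j)$. A family consists of $k$ pairwise disjoint lattice paths, the $a$-th starting at $(a^*,1)$ ($a=1,\dots,k$), each ending on the right edge (column $q$) or bottom edge (row $p^*$). Each endpoint gets a label: $i^*$ for $(i^*,q)$ with $i<p$, $j$ for $(p^*,j)$ with $j<q$, and either $p^*$ or $q$ for $(p^*,q)$. The endpoint set of the family is the set of its $k$ labels; $\mathcal E$ is the set of all subsets arising as endpoint sets of some family. -}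

module Defs where

open import Data.Nat using (ℕ; zero; suc; _+_; _≤_; _<_; _≤?_)
open import Data.Fin using (Fin; toℕ)
open import Data.Fin.Subset using (Subset; _∈_; _∩_; ∣_∣)
open import Data.Vec using (tabulate)
open import Data.Product using (_×_; _,_; Σ; ∃)
open import Data.Sum using (_⊎_; inj₁; inj₂)
open import Data.List using (List; []; _∷_)
open import Data.List.Relation.Unary.All using (All)
import Data.List.Membership.Propositional as LM
open import Data.Empty using (⊥)
open import Relation.Nullary using (¬_; does)
open import Relation.Binary.PropositionalEquality using (_≡_; _≢_)
open import Function.Bundles using (_⇔_)

-- Grid points are pairs (r , c) of natural numbers, 0-indexed:
-- (r , c) stands for the paper's point ((r+1)^* , c+1).
Point : Set
Point = ℕ × ℕ

InGrid : ℕ → ℕ → Point → Set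
InGrid p q (r , c) = (r < p) × (c < q)

data Step : Set where
  east  : Step
  south : Step

move : Point → Step → Point
move (r , c) east  = (r , suc c)
move (r , c) south = (suc r , c)

points : Point → List Step → List Point
points x []       = x ∷ []
points x (s ∷ ss) = x ∷ points (move x s) ss

endpoint : Point → List Step → Point
endpoint x []       = x
endpoint x (s ∷ ss) = endpoint (move x s) ss

start : {k : ℕ} → Fin k → Point
start a = (toℕ a , 0)

OnEdge : ℕ → ℕ → Point → Set
OnEdge p q (r , c) = (suc c ≡ q) ⊎ (suc r ≡ p)

Family : ℕ → Set
Family k = Fin k → List Step

ValidFamily : (p q k : ℕ) → Family k → Set
ValidFamily p q k F =
    ((a : Fin k) → All (InGrid p q) (points (start a) (F a)))
  × ((a : Fin k) → OnEdge p q (endpoint (start a) (F a)))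
  × ((a b : Fin k) → a ≢ b → (x : Point) →
        x LM.∈ points (start a) (F a) → x LM.∈ points (start b) (F b) → ⊥)

-- Labels: inj₁ i is the row label (toℕ i + 1)^* ∈ [p]^*,
--         inj₂ j is the column label (toℕ j + 1) ∈ [q].
Label : ℕ → ℕ → Set
Label p q = Fin p ⊎ Fin q

-- Admissible labels of an endpoint:
--  (i^*, q) gets label i^*, (p^*, j) gets label j, and the corner (p^*, q)
--  may get either p^* or q.
ValidLabel : (p q : ℕ) → Point → Label p q → Set
ValidLabel p q (r , c) (inj₁ i) = (toℕ i ≡ r) × (suc c ≡ q)
ValidLabel p q (r , c) (inj₂ j) = (toℕ j ≡ c) × (suc r ≡ p)

LSubset : ℕ → ℕ → Set
LSubset p q = Subset p × Subset q

_∈L_ : {p q : ℕ} → Label p q → LSubset p q → Set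
inj₁ i ∈L (R , C) = i ∈ R
inj₂ j ∈L (R , C) = j ∈ C

card : {p q : ℕ} → LSubset p q → ℕ
card (R , C) = ∣ R ∣ + ∣ C ∣

IsEndpointSet : (p q k : ℕ) → Family k → (Fin k → Label p q) → LSubset p q → Set
IsEndpointSet p q k F lab E =
    ((a : Fin k) → ValidLabel p q (endpoint (start a) (F a)) (lab a))
  × ((x : Label p q) → (x ∈L E) ⇔ ∃ (λ a → lab a ≡ x))

InEndpointSets : (p q k : ℕ) → LSubset p q → Set
InEndpointSets p q k E =
  Σ (Family k) λ F → ValidFamily p q k F ×
    Σ (Fin k → Label p q) λ lab → IsEndpointSet p q k F lab E

-- The set of the last ℓ indices of [n]: { i ∈ [n] : i > n - ℓ }
-- (1-indexed i = toℕ i + 1, so the condition is n ≤ toℕ i + ℓ).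
lastSub : (n ℓ : ℕ) → Subset n
lastSub n ℓ = tabulate (λ i → does (n ≤? toℕ i + ℓ))

Esub : {p q : ℕ} → ℕ → LSubset p q → LSubset p q
Esub {p} {q} ℓ (R , C) = (R ∩ lastSub p ℓ , C ∩ lastSub q ℓ)

{-# OPTIONS --safe #-}
-- Necessity. No path starts beyond the antidiagonal r + c = p + q − ℓ − 1 (rows and columns
-- counted from 0), and every path whose label lies in E_ℓ ends on or beyond it, so it crosses
-- it. Inside the grid this antidiagonal meets only the last ℓ rows, once each, and disjoint
-- paths cross it at distinct points; hence #E_ℓ ≤ ℓ.
--
-- Sufficiency, by induction on k. Remove from E the label x nearest to the corner and read the
-- rest as labels of the (p − 1) × (q − 1) grid: all distances to the corner drop by one, so the
-- hook condition for E at ℓ + 1 gives it for the smaller set at ℓ. If x is a row label, shift a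
-- family realising the smaller set one row down, continue each path that ended at row ρ one step
-- east and then down the last column to the next row label of E after ρ, and add a new outermost
-- path along the first row and down the last column to the least row label of E; the stretches
-- of the last column used by different paths are separated by consecutive row labels of E. If x
-- is a column label, transpose this picture, except that the new path is the innermost one,
-- starting at (k , 0) and running down the first column and along the last row.
module Submission where

open import Defs
open import Data.Nat using (ℕ; zero; suc; _+_; _∸_; _≤_; _<_; z≤n; s≤s; _≤?_; _<?_)
open import Data.Nat.Properties
open import Data.Nat.Tactic.RingSolver using (solve-∀)
open import Data.Fin as Fin using (Fin; zero; suc; toℕ; inject₁; fromℕ; fromℕ<; lower₁; splitAt)
import Data.Fin.Properties as Finₚ
open import Data.Fin.Subset using (Subset; inside; outside; _∈_; _∉_; _⊆_; _∩_; _-_; ∣_∣; Empty)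
open import Data.Fin.Subset.Properties
  using (_∈?_; nonempty?; x∈p∩q⁺; x∈p∩q⁻; p─q⊆p; p─⊥≡p; x∈p∧x≢y⇒x∈p-y; x∈p⇒∣p-x∣<∣p∣;
         p⊆q⇒∣p∣≤∣q∣; Empty-unique; ∣⊥∣≡0)
open import Data.Vec using (_∷_; []; init; here; there)
open import Data.Vec.Properties using (lookup∘tabulate; lookup⇒[]=; []=⇒lookup)
open import Data.List as List using (List; []; _∷_; _++_; replicate)
open import Data.List.Membership.Propositional using () renaming (_∈_ to _∈ₗ_)
open import Data.List.Membership.Propositional.Properties using (∈-map⁻)
open import Data.List.Relation.Unary.Any using (here; there)
open import Data.List.Relation.Unary.All as All using (All)
open import Data.Maybe as Maybe using (Maybe; just; nothing; maybe′)
open import Data.Product using (_×_; _,_; proj₁; proj₂; ∃; swap)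
open import Data.Sum as Sum using (_⊎_; inj₁; inj₂)
import Data.Sum.Properties as Sumₚ
open import Data.Bool.Properties using (T-≡)
open import Data.Empty using (⊥; ⊥-elim)
open import Function using (_∘_)
open import Function.Bundles using (_⇔_; mk⇔; Equivalence; _↔_; Inverse; mk↔ₛ′)
open import Function.Definitions using (Injective)
open import Level using (0ℓ)
open import Relation.Nullary using (¬_; Dec; yes; no; contradiction)
open import Relation.Nullary.Decidable using (dec-true; _×-dec_)
open import Relation.Unary using (Pred; Decidable)
open import Relation.Binary.Definitions using (tri<; tri≈; tri>)
open import Relation.Binary.PropositionalEquality

private variable
  n m : ℕ

least : ∀ {P : Pred (Fin n) 0ℓ} → Decidable P → ∃ P →
        ∃ λ i → P i × (∀ {j} → P j → i Fin.≤ j)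
least {suc n} P? (i , pᵢ) with P? zero
... | yes p₀ = zero , p₀ , λ _ → z≤n
least {suc n} P? (zero , pᵢ)      | no ¬p₀ = contradiction pᵢ ¬p₀
least {suc n} {P} P? (suc i , pᵢ) | no ¬p₀ with least (P? ∘ suc) (i , pᵢ)
... | m , pₘ , m-least = suc m , pₘ , suc-m-least
  where
  suc-m-least : ∀ {j} → P j → suc m Fin.≤ j
  suc-m-least {zero}  p₀ = contradiction p₀ ¬p₀
  suc-m-least {suc j} pⱼ = s≤s (m-least pⱼ)

greatest : ∀ {P : Pred (Fin n) 0ℓ} → Decidable P → ∃ P →
           ∃ λ i → P i × (∀ {j} → P j → j Fin.≤ i)
greatest {suc n} P? (i , pᵢ) with Finₚ.any? (P? ∘ suc)
greatest {suc n} {P} P? _ | yes ∃P∘suc with greatest (P? ∘ suc) ∃P∘suc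
... | m , pₘ , m-greatest = suc m , pₘ , below-suc-m
  where
  below-suc-m : ∀ {j} → P j → j Fin.≤ suc m
  below-suc-m {zero}  _  = z≤n
  below-suc-m {suc j} pⱼ = s≤s (m-greatest pⱼ)
greatest {suc n} P? (suc i , pᵢ)   | no ∄P∘suc = contradiction (i , pᵢ) ∄P∘suc
greatest {suc n} {P} P? (zero , p₀) | no ∄P∘suc = zero , p₀ , below-zero
  where
  below-zero : ∀ {j} → P j → j Fin.≤ zero {n}
  below-zero {zero}  _  = z≤n
  below-zero {suc j} pⱼ = contradiction (j , pⱼ) ∄P∘suc

∈-init⁻ : ∀ {S : Subset (suc n)} {i} → i ∈ init S → inject₁ i ∈ S
∈-init⁻ {suc n} {inside ∷ S} {zero}  here      = here
∈-init⁻ {suc n} {_ ∷ S}      {suc i} (there i∈) = there (∈-init⁻ i∈)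

∈-init⁺ : ∀ {S : Subset (suc n)} {i} → inject₁ i ∈ S → i ∈ init S
∈-init⁺ {suc n} {inside ∷ S} {zero}  here      = here
∈-init⁺ {suc n} {_ ∷ S}      {suc i} (there i∈) = there (∈-init⁺ i∈)

∈⇒∈-init : ∀ {S : Subset (suc n)} {j} → j ∈ S → fromℕ n ∉ S →
           ∃ λ i → i ∈ init S × inject₁ i ≡ j
∈⇒∈-init {n} {S} {j} j∈ n∉ = i , ∈-init⁺ (subst (_∈ S) (sym inject₁-i) j∈) , inject₁-i
  where
  j≢n : n ≢ toℕ j
  j≢n n≡j = n∉ (subst (_∈ S) (Finₚ.toℕ-injective (trans (sym n≡j) (sym (Finₚ.toℕ-fromℕ n))))
                       j∈)
  i : Fin n
  i = lower₁ j j≢n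
  inject₁-i : inject₁ i ≡ j
  inject₁-i = Finₚ.inject₁-lower₁ j j≢n

∣init[p]∣≤∣p∣ : ∀ (S : Subset (suc n)) → ∣ init S ∣ ≤ ∣ S ∣
∣init[p]∣≤∣p∣ {zero}  (_ ∷ [])      = z≤n
∣init[p]∣≤∣p∣ {suc n} (inside ∷ S)  = s≤s (∣init[p]∣≤∣p∣ S)
∣init[p]∣≤∣p∣ {suc n} (outside ∷ S) = ∣init[p]∣≤∣p∣ S

∣init[p]∣≡∣p∣ : ∀ (S : Subset (suc n)) → fromℕ n ∉ S → ∣ init S ∣ ≡ ∣ S ∣
∣init[p]∣≡∣p∣ {zero}  (inside ∷ [])  n∉ = contradiction here n∉
∣init[p]∣≡∣p∣ {zero}  (outside ∷ []) n∉ = refl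
∣init[p]∣≡∣p∣ {suc n} (inside ∷ S)   n∉ = cong suc (∣init[p]∣≡∣p∣ S (n∉ ∘ there))
∣init[p]∣≡∣p∣ {suc n} (outside ∷ S)  n∉ = ∣init[p]∣≡∣p∣ S (n∉ ∘ there)

x∈p-y⇒x≢y : ∀ {p : Subset n} {x y} → x ∈ p - y → x ≢ y
x∈p-y⇒x≢y {p = _ ∷ p} {zero}  {suc y} _          ()
x∈p-y⇒x≢y {p = _ ∷ p} {suc x} {zero}  _          ()
x∈p-y⇒x≢y {p = _ ∷ p} {suc x} {suc y} (there x∈) refl = x∈p-y⇒x≢y x∈ refl

suc∣p-x∣≡∣p∣ : ∀ {p : Subset n} {x} → x ∈ p → suc ∣ p - x ∣ ≡ ∣ p ∣
suc∣p-x∣≡∣p∣ {p = inside ∷ p}  {zero}  here       = cong (suc ∘ ∣_∣) (p─⊥≡p p)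
suc∣p-x∣≡∣p∣ {p = inside ∷ p}  {suc x} (there x∈) = cong suc (suc∣p-x∣≡∣p∣ x∈)
suc∣p-x∣≡∣p∣ {p = outside ∷ p} {suc x} (there x∈) = suc∣p-x∣≡∣p∣ x∈

x∈p⇒0<∣p∣ : ∀ {p : Subset n} {x} → x ∈ p → 0 < ∣ p ∣
x∈p⇒0<∣p∣ x∈ = ≤-<-trans z≤n (x∈p⇒∣p-x∣<∣p∣ x∈)

Empty⇒∣p∣≡0 : ∀ {p : Subset n} → Empty p → ∣ p ∣ ≡ 0
Empty⇒∣p∣≡0 {n} p-empty = trans (cong ∣_∣ (Empty-unique p-empty)) (∣⊥∣≡0 n)

∈-lastSub⁻ : ∀ {ℓ} {i : Fin n} → i ∈ lastSub n ℓ → n ≤ toℕ i + ℓ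
∈-lastSub⁻ {n} {ℓ} {i} i∈ = ≤ᵇ⇒≤ n (toℕ i + ℓ)
  (Equivalence.from T-≡ (trans (sym (lookup∘tabulate _ i)) ([]=⇒lookup i∈)))

∈-lastSub⁺ : ∀ {ℓ} {i : Fin n} → n ≤ toℕ i + ℓ → i ∈ lastSub n ℓ
∈-lastSub⁺ {n} {ℓ} {i} n≤i+ℓ =
  lookup⇒[]= i _ (trans (lookup∘tabulate _ i) (dec-true (n ≤? toℕ i + ℓ) n≤i+ℓ))

enumerate : ∀ (S : Subset n) → Fin ∣ S ∣ → Fin n
enumerate (inside ∷ S)  zero    = zero
enumerate (inside ∷ S)  (suc i) = suc (enumerate S i)
enumerate (outside ∷ S) i       = suc (enumerate S i)

enumerate-∈ : ∀ (S : Subset n) i → enumerate S i ∈ S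
enumerate-∈ (inside ∷ S)  zero    = here
enumerate-∈ (inside ∷ S)  (suc i) = there (enumerate-∈ S i)
enumerate-∈ (outside ∷ S) i       = there (enumerate-∈ S i)

enumerate-injective : ∀ (S : Subset n) → Injective _≡_ _≡_ (enumerate S)
enumerate-injective (inside ∷ S)  {zero}  {zero}  _  = refl
enumerate-injective (inside ∷ S)  {suc i} {suc j} eq =
  cong suc (enumerate-injective S (Finₚ.suc-injective eq))
enumerate-injective (outside ∷ S)                 eq = enumerate-injective S (Finₚ.suc-injective eq)

splitAt-injective : ∀ m {n} → Injective _≡_ _≡_ (splitAt m {n})
splitAt-injective m {n} {i} {j} eq = begin
  i                        ≡⟨ Finₚ.join-splitAt m n i ⟨
  Fin.join m n (splitAt m i) ≡⟨ cong (Fin.join m n) eq ⟩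
  Fin.join m n (splitAt m j) ≡⟨ Finₚ.join-splitAt m n j ⟩
  j                        ∎
  where open ≡-Reasoning

module _ {p q : ℕ} where

  enumerateL : ∀ (E : LSubset p q) → Fin (card E) → Label p q
  enumerateL (R , C) = Sum.map (enumerate R) (enumerate C) ∘ splitAt ∣ R ∣

  enumerateL-∈ : ∀ E i → enumerateL E i ∈L E
  enumerateL-∈ (R , C) i with splitAt ∣ R ∣ i
  ... | inj₁ r = enumerate-∈ R r
  ... | inj₂ c = enumerate-∈ C c

  enumerateL-injective : ∀ E → Injective _≡_ _≡_ (enumerateL E)
  enumerateL-injective (R , C) eq = splitAt-injective ∣ R ∣ (map-injective eq)
    where
    map-injective : Injective _≡_ _≡_ (Sum.map (enumerate R) (enumerate C))
    map-injective {inj₁ r} {inj₁ r′} eq = cong inj₁ (enumerate-injective R (Sumₚ.inj₁-injective eq))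
    map-injective {inj₂ c} {inj₂ c′} eq = cong inj₂ (enumerate-injective C (Sumₚ.inj₂-injective eq))

  card≤-injection : ∀ (E : LSubset p q) (f : ∀ x → x ∈L E → Fin m) →
                    (∀ {x y} (x∈ : x ∈L E) (y∈ : y ∈L E) → f x x∈ ≡ f y y∈ → x ≡ y) →
                    card E ≤ m
  card≤-injection E f f-injective = Finₚ.injective⇒≤ λ eq →
    enumerateL-injective E (f-injective (enumerateL-∈ E _) (enumerateL-∈ E _) eq)

translate : Point → Point → Point
translate (dr , dc) (r , c) = (dr + r , dc + c)

down right : Point → Point
down  = translate (1 , 0)
right = translate (0 , 1)

level : Point → ℕ
level (r , c) = r + c

OnRow : ℕ → ℕ → ℕ → Point → Set
OnRow r from to y = proj₁ y ≡ r × from ≤ proj₂ y × proj₂ y ≤ to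

OnColumn : ℕ → ℕ → ℕ → Point → Set
OnColumn c from to y = proj₂ y ≡ c × from ≤ proj₁ y × proj₁ y ≤ to

move-translate : ∀ d x s → move (translate d x) s ≡ translate d (move x s)
move-translate (dr , dc) (r , c) east  = cong (dr + r ,_) (sym (+-suc dc c))
move-translate (dr , dc) (r , c) south = cong (_, dc + c) (sym (+-suc dr r))

points-translate : ∀ d x ss → points (translate d x) ss ≡ List.map (translate d) (points x ss)
points-translate d x []       = refl
points-translate d x (s ∷ ss) = cong (translate d x ∷_) (begin
  points (move (translate d x) s) ss       ≡⟨ cong (λ y → points y ss) (move-translate d x s) ⟩
  points (translate d (move x s)) ss       ≡⟨ points-translate d (move x s) ss ⟩
  List.map (translate d) (points (move x s) ss) ∎)
  where open ≡-Reasoning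

endpoint-translate : ∀ d x ss → endpoint (translate d x) ss ≡ translate d (endpoint x ss)
endpoint-translate d x []       = refl
endpoint-translate d x (s ∷ ss) =
  trans (cong (λ y → endpoint y ss) (move-translate d x s)) (endpoint-translate d (move x s) ss)

∈-points-translate⁻ : ∀ d x ss {y} → y ∈ₗ points (translate d x) ss →
                      ∃ λ z → z ∈ₗ points x ss × y ≡ translate d z
∈-points-translate⁻ d x ss y∈ =
  ∈-map⁻ (translate d) (subst (_ ∈ₗ_) (points-translate d x ss) y∈)

translate-injective : ∀ d {y z} → translate d y ≡ translate d z → y ≡ z
translate-injective (dr , dc) {r , c} {r′ , c′} eq =
  cong₂ _,_ (+-cancelˡ-≡ dr r r′ (cong proj₁ eq)) (+-cancelˡ-≡ dc c c′ (cong proj₂ eq))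

endpoint-++ : ∀ x ss ts → endpoint x (ss ++ ts) ≡ endpoint (endpoint x ss) ts
endpoint-++ x []       ts = refl
endpoint-++ x (s ∷ ss) ts = endpoint-++ (move x s) ss ts

endpoint∈points : ∀ x ss → endpoint x ss ∈ₗ points x ss
endpoint∈points x []       = here refl
endpoint∈points x (s ∷ ss) = there (endpoint∈points (move x s) ss)

∈-points-++⁻ : ∀ x ss ts {y} → y ∈ₗ points x (ss ++ ts) →
               y ∈ₗ points x ss ⊎ y ∈ₗ points (endpoint x ss) ts
∈-points-++⁻ x []       ts y∈         = inj₂ y∈
∈-points-++⁻ x (s ∷ ss) ts (here y≡x) = inj₁ (here y≡x)
∈-points-++⁻ x (s ∷ ss) ts (there y∈) with ∈-points-++⁻ (move x s) ss ts y∈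
... | inj₁ y∈ss = inj₁ (there y∈ss)
... | inj₂ y∈ts = inj₂ y∈ts

endpoint-east : ∀ r c n → endpoint (r , c) (replicate n east) ≡ (r , c + n)
endpoint-east r c zero    = cong (r ,_) (sym (+-identityʳ c))
endpoint-east r c (suc n) = trans (endpoint-east r (suc c) n) (cong (r ,_) (sym (+-suc c n)))

endpoint-south : ∀ r c n → endpoint (r , c) (replicate n south) ≡ (r + n , c)
endpoint-south r c zero    = cong (_, c) (sym (+-identityʳ r))
endpoint-south r c (suc n) = trans (endpoint-south (suc r) c n) (cong (_, c) (sym (+-suc r n)))

∈-points-east⁻ : ∀ r c n {y} → y ∈ₗ points (r , c) (replicate n east) → OnRow r c (c + n) y
∈-points-east⁻ r c zero    (here refl) = refl , ≤-refl , m≤m+n c 0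
∈-points-east⁻ r c (suc n) (here refl) = refl , ≤-refl , m≤m+n c (suc n)
∈-points-east⁻ r c (suc n) (there y∈) with ∈-points-east⁻ r (suc c) n y∈
... | y-row , c<y , y≤ = y-row , <⇒≤ c<y , ≤-trans y≤ (≤-reflexive (sym (+-suc c n)))

∈-points-south⁻ : ∀ r c n {y} → y ∈ₗ points (r , c) (replicate n south) → OnColumn c r (r + n) y
∈-points-south⁻ r c zero    (here refl) = refl , ≤-refl , m≤m+n r 0
∈-points-south⁻ r c (suc n) (here refl) = refl , ≤-refl , m≤m+n r (suc n)
∈-points-south⁻ r c (suc n) (there y∈) with ∈-points-south⁻ (suc r) c n y∈
... | y-col , r<y , y≤ = y-col , <⇒≤ r<y , ≤-trans y≤ (≤-reflexive (sym (+-suc r n)))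

level-row-injective : ∀ {y y′} → level y ≡ level y′ → proj₁ y ≡ proj₁ y′ → y ≡ y′
level-row-injective {r , c} {.r , c′} r+c≡r+c′ refl = cong (r ,_) (+-cancelˡ-≡ r c c′ r+c≡r+c′)

level-move : ∀ x s → level (move x s) ≡ suc (level x)
level-move (r , c) east  = +-suc r c
level-move (r , c) south = refl

crosses-level : ∀ x ss {d} → level x ≤ d → d ≤ level (endpoint x ss) →
                ∃ λ y → y ∈ₗ points x ss × level y ≡ d
crosses-level x []       x≤d d≤x = x , here refl , ≤-antisym x≤d d≤x
crosses-level x (s ∷ ss) {d} x≤d d≤end with level x ≟ d
... | yes x≡d = x , here refl , x≡d
... | no  x≢d
  with crosses-level (move x s) ss (subst (_≤ d) (sym (level-move x s)) (≤∧≢⇒< x≤d x≢d)) d≤end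
...   | y , y∈ , y≡d = y , there y∈ , y≡d

validLabel-onEdge : ∀ {p q} z (l : Label p q) → ValidLabel p q z l → OnEdge p q z
validLabel-onEdge (r , c) (inj₁ i) (_ , c≡q) = inj₁ c≡q
validLabel-onEdge (r , c) (inj₂ j) (_ , r≡p) = inj₂ r≡p

validLabel-unique : ∀ {p q} {z z′} (l : Label p q) →
                    ValidLabel p q z l → ValidLabel p q z′ l → z ≡ z′
validLabel-unique {z = r , c} {r′ , c′} (inj₁ i) (i≡r , c≡) (i≡r′ , c′≡) =
  cong₂ _,_ (trans (sym i≡r) i≡r′) (suc-injective (trans c≡ (sym c′≡)))
validLabel-unique {z = r , c} {r′ , c′} (inj₂ j) (j≡c , r≡) (j≡c′ , r′≡) =
  cong₂ _,_ (suc-injective (trans r≡ (sym r′≡))) (trans (sym j≡c) j≡c′)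

record Linkage (p q : ℕ) {I : Set} (origin : I → Point) (E : LSubset p q) : Set where
  field
    steps     : I → List Step
    label     : I → Label p q
    inGrid    : ∀ a → All (InGrid p q) (points (origin a) (steps a))
    labelled  : ∀ a → ValidLabel p q (endpoint (origin a) (steps a)) (label a)
    disjoint  : ∀ {a b} → a ≢ b → ∀ {y} →
                y ∈ₗ points (origin a) (steps a) → y ∈ₗ points (origin b) (steps b) → ⊥
    endpoints : ∀ x → x ∈L E ⇔ ∃ λ a → label a ≡ x

  label≡⇒∈ : ∀ {a x} → label a ≡ x → x ∈L E
  label≡⇒∈ {a} {x} a↦x = Equivalence.from (endpoints x) (a , a↦x)

  label∈ : ∀ a → label a ∈L E
  label∈ a = label≡⇒∈ refl

  inGrid-at : ∀ {a y} → y ∈ₗ points (origin a) (steps a) → InGrid p q y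
  inGrid-at {a} = All.lookup (inGrid a)

  distinct-labels : ∀ {a b} → a ≢ b → label a ≢ label b
  distinct-labels {a} {b} a≢b la≡lb = disjoint a≢b (endpoint∈points (origin a) (steps a))
    (subst (_∈ₗ points (origin b) (steps b)) same-end (endpoint∈points (origin b) (steps b)))
    where
    same-end : endpoint (origin b) (steps b) ≡ endpoint (origin a) (steps a)
    same-end = validLabel-unique (label a) (subst (ValidLabel p q _) (sym la≡lb) (labelled b)) (labelled a)

module _ {p q k : ℕ} {E : LSubset p q} where

  toLinkage : InEndpointSets p q k E → Linkage p q start E
  toLinkage (F , (inGrid , _ , disjoint) , lab , (labelled , endpoints)) = record
    { steps = F ; label = lab ; inGrid = inGrid ; labelled = labelled
    ; disjoint = λ a≢b → disjoint _ _ a≢b _ ; endpoints = endpoints }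

  fromLinkage : Linkage p q start E → InEndpointSets p q k E
  fromLinkage L =
    steps , (inGrid , onEdge , λ a b a≢b _ → disjoint a≢b) , label , (labelled , endpoints)
    where
    open Linkage L
    onEdge : ∀ a → OnEdge p q (endpoint (start a) (steps a))
    onEdge a = validLabel-onEdge _ (label a) (labelled a)

reindex : ∀ {p q} {I J : Set} {origin : I → Point} {origin′ : J → Point} {E : LSubset p q} →
          (σ : I ↔ J) → (∀ i → origin′ (Inverse.to σ i) ≡ origin i) →
          Linkage p q origin E → Linkage p q origin′ E
reindex {p} {q} {origin = origin} {origin′} {E} σ origin-σ L = record
  { steps     = steps ∘ from
  ; label     = label ∘ from
  ; inGrid    = λ j → subst (λ o → All (InGrid p q) (points o (steps (from j))))
                          (origin-from j) (inGrid (from j))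
  ; labelled  = λ j → subst (λ o → ValidLabel p q (endpoint o (steps (from j))) (label (from j)))
                          (origin-from j) (labelled (from j))
  ; disjoint  = λ a≢b y∈a y∈b → disjoint (a≢b ∘ from-injective) (on-path y∈a) (on-path y∈b)
  ; endpoints = λ x → mk⇔ (realised x) (λ (j , j↦x) → Equivalence.from (endpoints x) (from j , j↦x))
  }
  where
  open Linkage L
  open Inverse σ
  origin-from : ∀ j → origin (from j) ≡ origin′ j
  origin-from j = trans (sym (origin-σ (from j))) (cong origin′ (strictlyInverseˡ j))
  from-injective : ∀ {a b} → from a ≡ from b → a ≡ b
  from-injective {a} {b} eq =
    trans (sym (strictlyInverseˡ a)) (trans (cong to eq) (strictlyInverseˡ b))
  on-path : ∀ {j y} → y ∈ₗ points (origin′ j) (steps (from j)) →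
            y ∈ₗ points (origin (from j)) (steps (from j))
  on-path {j} {y} = subst (λ o → y ∈ₗ points o (steps (from j))) (sym (origin-from j))
  realised : ∀ x → x ∈L E → ∃ λ j → label (from j) ≡ x
  realised x x∈ with Equivalence.to (endpoints x) x∈
  ... | a , a↦x = to a , trans (cong label (strictlyInverseʳ a)) a↦x

unInject₁ : ∀ {n} → Fin (suc n) → Maybe (Fin n)
unInject₁ {zero}  Fin.zero    = nothing
unInject₁ {suc n} Fin.zero    = just Fin.zero
unInject₁ {suc n} (Fin.suc i) = Maybe.map Fin.suc (unInject₁ i)

Maybe↔Fin : ∀ n → Maybe (Fin n) ↔ Fin (suc n)
Maybe↔Fin n = mk↔ₛ′ (maybe′ inject₁ (fromℕ n)) unInject₁ (to-from n) (from-to n)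
  where
  to-from : ∀ n (i : Fin (suc n)) → maybe′ inject₁ (fromℕ n) (unInject₁ i) ≡ i
  to-from zero    Fin.zero    = refl
  to-from (suc n) Fin.zero    = refl
  to-from (suc n) (Fin.suc i) with unInject₁ i | to-from n i
  ... | nothing | eq = cong Fin.suc eq
  ... | just a  | eq = cong Fin.suc eq
  from-to : ∀ n (m : Maybe (Fin n)) → unInject₁ (maybe′ inject₁ (fromℕ n) m) ≡ m
  from-to zero    nothing           = refl
  from-to (suc n) nothing           = cong (Maybe.map Fin.suc) (from-to n nothing)
  from-to (suc n) (just Fin.zero)   = refl
  from-to (suc n) (just (Fin.suc a)) = cong (Maybe.map Fin.suc) (from-to n (just a))

-- Necessity of the hook condition

∈-Esub⁻ : ∀ {p q ℓ} {E : LSubset p q} x → x ∈L Esub ℓ E → x ∈L E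
∈-Esub⁻ (inj₁ i) = proj₁ ∘ x∈p∩q⁻ _ _
∈-Esub⁻ (inj₂ j) = proj₁ ∘ x∈p∩q⁻ _ _

module Necessity {p q k} (k≤p : k ≤ p) (k≤q : k ≤ q) {E : LSubset p q}
                 (L : Linkage p q (start {k}) E) {ℓ} (ℓ≤k : ℓ ≤ k) where
  open Linkage L

  d : ℕ
  d = p + q ∸ suc ℓ

  d≤ : ∀ {n} → p + q ≤ n + suc ℓ → d ≤ n
  d≤ {n} h = ≤-trans (∸-monoˡ-≤ (suc ℓ) h) (≤-reflexive (m+n∸n≡m n (suc ℓ)))

  start≤d : ∀ a → level (start a) ≤ d
  start≤d a = m+n≤o⇒m≤o∸n (toℕ a + 0) (begin
    toℕ a + 0 + suc ℓ ≡⟨ shuffle (toℕ a) ℓ ⟩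
    suc (toℕ a) + ℓ   ≤⟨ +-mono-≤ (≤-trans (Finₚ.toℕ<n a) k≤p) (≤-trans ℓ≤k k≤q) ⟩
    p + q             ∎)
    where
    open ≤-Reasoning
    shuffle : ∀ a ℓ → a + 0 + suc ℓ ≡ suc a + ℓ
    shuffle = solve-∀

  d≤endpoint : ∀ {z} x → x ∈L Esub ℓ E → ValidLabel p q z x → d ≤ level z
  d≤endpoint {r , c} (inj₁ i) i∈ (i≡r , c+1≡q) = d≤ (begin
    p + q                 ≡⟨ cong (p +_) (sym c+1≡q) ⟩
    p + suc c             ≤⟨ +-monoˡ-≤ (suc c) (subst (λ t → p ≤ t + ℓ) i≡r i-near) ⟩
    r + ℓ + suc c         ≡⟨ shuffle r c ℓ ⟩
    r + c + suc ℓ         ∎)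
    where
    open ≤-Reasoning
    i-near : p ≤ toℕ i + ℓ
    i-near = ∈-lastSub⁻ (proj₂ (x∈p∩q⁻ _ _ i∈))
    shuffle : ∀ r c ℓ → r + ℓ + suc c ≡ r + c + suc ℓ
    shuffle = solve-∀
  d≤endpoint {r , c} (inj₂ j) j∈ (j≡c , r+1≡p) = d≤ (begin
    p + q                 ≡⟨ cong (_+ q) (sym r+1≡p) ⟩
    suc r + q             ≤⟨ +-monoʳ-≤ (suc r) (subst (λ t → q ≤ t + ℓ) j≡c j-near) ⟩
    suc r + (c + ℓ)       ≡⟨ shuffle r c ℓ ⟩
    r + c + suc ℓ         ∎)
    where
    open ≤-Reasoning
    j-near : q ≤ toℕ j + ℓ
    j-near = ∈-lastSub⁻ (proj₂ (x∈p∩q⁻ _ _ j∈))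
    shuffle : ∀ r c ℓ → suc r + (c + ℓ) ≡ r + c + suc ℓ
    shuffle = solve-∀

  near-corner : ∀ {y} → InGrid p q y → level y ≡ d → p ≤ proj₁ y + ℓ
  near-corner {r , c} (_ , c<q) r+c≡d = +-cancelʳ-≤ q p (r + ℓ) (begin
    p + q                 ≤⟨ m≤n+m∸n (p + q) (suc ℓ) ⟩
    suc ℓ + d             ≡⟨ +-comm (suc ℓ) d ⟩
    d + suc ℓ             ≡⟨ cong (_+ suc ℓ) (sym r+c≡d) ⟩
    r + c + suc ℓ         ≡⟨ shuffle r c ℓ ⟩
    r + ℓ + suc c         ≤⟨ +-monoʳ-≤ (r + ℓ) c<q ⟩
    r + ℓ + q             ∎)
    where
    open ≤-Reasoning
    shuffle : ∀ r c ℓ → r + c + suc ℓ ≡ r + ℓ + suc c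
    shuffle = solve-∀

  record Crossing (x : Label p q) : Set where
    field
      path       : Fin k
      path-label : label path ≡ x
      point      : Point
      on-path    : point ∈ₗ points (start path) (steps path)
      on-d       : level point ≡ d

    inGrid-point : InGrid p q point
    inGrid-point = inGrid-at on-path

    row-index : Fin ℓ
    row-index = fromℕ< {proj₁ point + ℓ ∸ p} (begin-strict
      proj₁ point + ℓ ∸ p
        <⟨ ∸-monoˡ-< (+-monoˡ-< ℓ (proj₁ inGrid-point)) (near-corner inGrid-point on-d) ⟩
      p + ℓ ∸ p
        ≡⟨ m+n∸m≡n p ℓ ⟩
      ℓ ∎)
      where open ≤-Reasoning

  open Crossing

  crossing : ∀ x → x ∈L Esub ℓ E → Crossing x
  crossing x x∈ with Equivalence.to (endpoints x) (∈-Esub⁻ x x∈)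
  ... | a , a↦x with crosses-level (start a) (steps a) (start≤d a)
                       (d≤endpoint x x∈ (subst (ValidLabel p q _) a↦x (labelled a)))
  ... | y , y∈ , y-on-d = record
    { path = a ; path-label = a↦x ; point = y ; on-path = y∈ ; on-d = y-on-d }

  row-index-injective : ∀ {x x′} (X : Crossing x) (X′ : Crossing x′) →
                        row-index X ≡ row-index X′ → x ≡ x′
  row-index-injective X X′ eq with path X Finₚ.≟ path X′
  ... | yes same = trans (sym (path-label X)) (trans (cong label same) (path-label X′))
  ... | no different = ⊥-elim (disjoint different (on-path X) on-path′)
    where
    same-row : proj₁ (point X) ≡ proj₁ (point X′)
    same-row = +-cancelʳ-≡ ℓ _ _ (∸-cancelʳ-≡ (near-corner (inGrid-point X) (on-d X))
                                              (near-corner (inGrid-point X′) (on-d X′))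
                                              (Finₚ.fromℕ<-injective _ _ _ _ eq))
    same-point : point X ≡ point X′
    same-point = level-row-injective (trans (on-d X) (sym (on-d X′))) same-row
    on-path′ : point X ∈ₗ points (start (path X′)) (steps (path X′))
    on-path′ = subst (_∈ₗ points (start (path X′)) (steps (path X′))) (sym same-point) (on-path X′)

  necessary : card (Esub ℓ E) ≤ ℓ
  necessary = card≤-injection (Esub ℓ E) (λ x x∈ → row-index (crossing x x∈))
                              (λ x∈ y∈ → row-index-injective (crossing _ x∈) (crossing _ y∈))

-- Removing the label nearest to the corner

HookCondition : ∀ {p q} → ℕ → LSubset p q → Set
HookCondition k E = (ℓ : ℕ) → 1 ≤ ℓ → ℓ ≤ k → card (Esub ℓ E) ≤ ℓ

card-swap : ∀ {p q} (E : LSubset p q) → card (swap E) ≡ card E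
card-swap (R , C) = +-comm ∣ C ∣ ∣ R ∣

hook-swap : ∀ {p q k} (E : LSubset p q) → HookCondition k E → HookCondition k (swap E)
hook-swap E hook ℓ 1≤ℓ ℓ≤k = subst (_≤ ℓ) (sym (card-swap (Esub ℓ E))) (hook ℓ 1≤ℓ ℓ≤k)

lastSub-upward : ∀ {n ℓ} {i j : Fin n} → i Fin.≤ j → i ∈ lastSub n ℓ → j ∈ lastSub n ℓ
lastSub-upward {ℓ = ℓ} i≤j i∈ = ∈-lastSub⁺ (≤-trans (∈-lastSub⁻ i∈) (+-monoˡ-≤ ℓ i≤j))

∣init∩lastSub∣≤ : ∀ {n} (A : Subset (suc n)) ℓ →
                  ∣ init A ∩ lastSub n ℓ ∣ ≤ ∣ A ∩ lastSub (suc n) (suc ℓ) ∣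
∣init∩lastSub∣≤ {n} A ℓ = ≤-trans (p⊆q⇒∣p∣≤∣q∣ ⊆init) (∣init[p]∣≤∣p∣ (A ∩ lastSub (suc n) (suc ℓ)))
  where
  ⊆init : init A ∩ lastSub n ℓ ⊆ init (A ∩ lastSub (suc n) (suc ℓ))
  ⊆init {i} i∈ with x∈p∩q⁻ _ _ i∈
  ... | i∈A , i-near = ∈-init⁺ (x∈p∩q⁺ (∈-init⁻ i∈A , ∈-lastSub⁺ (begin
    suc n                       ≤⟨ s≤s (∈-lastSub⁻ i-near) ⟩
    suc (toℕ i + ℓ)             ≡⟨ sym (+-suc (toℕ i) ℓ) ⟩
    toℕ i + suc ℓ               ≡⟨ cong (_+ suc ℓ) (sym (Finₚ.toℕ-inject₁ i)) ⟩
    toℕ (inject₁ i) + suc ℓ     ∎)))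
    where open ≤-Reasoning

-- Row label i of Fin (suc n) lies n − i steps from the corner, column label j of Fin (suc m)
-- lies m − j steps from it.
record Cornermost {n m} (S : Subset (suc n)) (T : Subset (suc m)) (x : Fin (suc n)) : Set where
  field
    x∈S       : x ∈ S
    S≤x       : ∀ {j} → j ∈ S → j Fin.≤ x
    T-farther : ∀ {j} → j ∈ T → toℕ j + n ≤ toℕ x + m

cornermost : ∀ {n m k} (S : Subset (suc n)) (T : Subset (suc m)) → ∣ S ∣ + ∣ T ∣ ≡ suc k →
             ∃ (Cornermost S T) ⊎ ∃ (Cornermost T S)
cornermost {n} {m} S T ∣S∣+∣T∣≡1+k with nonempty? S | nonempty? T
... | yes S≢∅ | yes T≢∅ with greatest (_∈? S) S≢∅ | greatest (_∈? T) T≢∅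
...   | xS , xS∈ , S≤xS | xT , xT∈ , T≤xT with toℕ xT + n ≤? toℕ xS + m
...     | yes xS-nearer = inj₁ (xS , record
          { x∈S       = xS∈
          ; S≤x       = S≤xS
          ; T-farther = λ j∈ → ≤-trans (+-monoˡ-≤ n (T≤xT j∈)) xS-nearer
          })
...     | no  xT-nearer = inj₂ (xT , record
          { x∈S       = xT∈
          ; S≤x       = T≤xT
          ; T-farther = λ j∈ → ≤-trans (+-monoˡ-≤ m (S≤xS j∈)) (<⇒≤ (≰⇒> xT-nearer))
          })
cornermost S T _ | yes S≢∅ | no T≡∅ with greatest (_∈? S) S≢∅
... | xS , xS∈ , S≤xS = inj₁ (xS , record
      { x∈S = xS∈ ; S≤x = S≤xS ; T-farther = λ j∈ → contradiction (_ , j∈) T≡∅ })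
cornermost S T _ | no S≡∅ | yes T≢∅ with greatest (_∈? T) T≢∅
... | xT , xT∈ , T≤xT = inj₂ (xT , record
      { x∈S = xT∈ ; S≤x = T≤xT ; T-farther = λ j∈ → contradiction (_ , j∈) S≡∅ })
cornermost S T ∣S∣+∣T∣≡1+k | no S≡∅ | no T≡∅ =
  contradiction (trans (sym (cong₂ _+_ (Empty⇒∣p∣≡0 S≡∅) (Empty⇒∣p∣≡0 T≡∅))) ∣S∣+∣T∣≡1+k) 0≢1+n

peel : ∀ {n m} → Fin (suc n) → LSubset (suc n) (suc m) → LSubset n m
peel x (S , T) = init (S - x) , init T

module Peel {n m} {S : Subset (suc n)} {T : Subset (suc m)} {x} (cm : Cornermost S T x) where
  open Cornermost cm

  last∉S-x : fromℕ n ∉ S - x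
  last∉S-x n∈ = x∈p-y⇒x≢y n∈ (Finₚ.toℕ-injective (≤-antisym
    (S≤x (p─q⊆p S _ n∈))
    (≤-trans (Finₚ.toℕ≤pred[n] x) (≤-reflexive (sym (Finₚ.toℕ-fromℕ n))))))

  last∉T : card (Esub 1 (S , T)) ≤ 1 → fromℕ m ∉ T
  last∉T E₁≤1 m∈ = contradiction E₁≤1 (<⇒≱ (+-mono-≤ (x∈p⇒0<∣p∣ x-near) (x∈p⇒0<∣p∣ m-near)))
    where
    n≤x : n ≤ toℕ x
    n≤x = +-cancelˡ-≤ m n (toℕ x) (begin
      m + n                 ≡⟨ cong (_+ n) (Finₚ.toℕ-fromℕ m) ⟨
      toℕ (fromℕ m) + n     ≤⟨ T-farther m∈ ⟩
      toℕ x + m             ≡⟨ +-comm (toℕ x) m ⟩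
      m + toℕ x             ∎)
      where open ≤-Reasoning
    x-near : x ∈ S ∩ lastSub (suc n) 1
    x-near = x∈p∩q⁺ (x∈S , ∈-lastSub⁺ (subst (suc n ≤_) (+-comm 1 (toℕ x)) (s≤s n≤x)))
    m-near : fromℕ m ∈ T ∩ lastSub (suc m) 1
    m-near = x∈p∩q⁺ (m∈ , ∈-lastSub⁺ (≤-reflexive (trans (+-comm 1 m) (cong (_+ 1) (sym (Finₚ.toℕ-fromℕ m))))))

  card-peel : ∀ {k} → fromℕ m ∉ T → card (S , T) ≡ suc k → card (peel x (S , T)) ≡ k
  card-peel m∉T ∣S∣+∣T∣≡1+k = suc-injective (begin
    suc (∣ init (S - x) ∣ + ∣ init T ∣)
      ≡⟨ cong₂ (λ a b → suc (a + b)) (∣init[p]∣≡∣p∣ _ last∉S-x) (∣init[p]∣≡∣p∣ _ m∉T) ⟩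
    suc ∣ S - x ∣ + ∣ T ∣              ≡⟨ cong (_+ ∣ T ∣) (suc∣p-x∣≡∣p∣ x∈S) ⟩
    ∣ S ∣ + ∣ T ∣                      ≡⟨ ∣S∣+∣T∣≡1+k ⟩
    suc _                              ∎)
    where open ≡-Reasoning

  hook-peel : ∀ {k} → HookCondition (suc k) (S , T) → HookCondition k (peel x (S , T))
  hook-peel hook ℓ _ ℓ≤k = ≤-trans peel≤ (bound (x ∈? L))
    where
    L : Subset (suc n)
    L = lastSub (suc n) (suc ℓ)
    L′ : Subset (suc m)
    L′ = lastSub (suc m) (suc ℓ)

    peel≤ : card (Esub ℓ (peel x (S , T))) ≤ ∣ (S - x) ∩ L ∣ + ∣ T ∩ L′ ∣
    peel≤ = +-mono-≤ (∣init∩lastSub∣≤ (S - x) ℓ) (∣init∩lastSub∣≤ T ℓ)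

    ⊆-x : (S - x) ∩ L ⊆ (S ∩ L) - x
    ⊆-x j∈ with x∈p∩q⁻ _ _ j∈
    ... | j∈S-x , j-near = x∈p∧x≢y⇒x∈p-y (x∈p∩q⁺ (p─q⊆p S _ j∈S-x , j-near)) (x∈p-y⇒x≢y j∈S-x)

    bound : Dec (x ∈ L) → ∣ (S - x) ∩ L ∣ + ∣ T ∩ L′ ∣ ≤ ℓ
    bound (yes x-near) = ≤-pred (begin
      suc ∣ (S - x) ∩ L ∣ + ∣ T ∩ L′ ∣ ≤⟨ +-monoˡ-≤ _ (s≤s (p⊆q⇒∣p∣≤∣q∣ ⊆-x)) ⟩
      suc ∣ (S ∩ L) - x ∣ + ∣ T ∩ L′ ∣ ≡⟨ cong (_+ ∣ T ∩ L′ ∣) (suc∣p-x∣≡∣p∣ (x∈p∩q⁺ (x∈S , x-near))) ⟩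
      ∣ S ∩ L ∣ + ∣ T ∩ L′ ∣           ≤⟨ hook (suc ℓ) (s≤s z≤n) (s≤s ℓ≤k) ⟩
      suc ℓ                            ∎)
      where open ≤-Reasoning
    bound (no x-far) = ≤-trans (≤-reflexive (cong₂ _+_ (Empty⇒∣p∣≡0 S-far) (Empty⇒∣p∣≡0 T-far))) z≤n
      where
      S-far : Empty ((S - x) ∩ L)
      S-far (j , j∈) with x∈p∩q⁻ _ _ j∈
      ... | j∈S-x , j-near = x-far (lastSub-upward (S≤x (p─q⊆p S _ j∈S-x)) j-near)
      T-far : Empty (T ∩ L′)
      T-far (j , j∈) with x∈p∩q⁻ _ _ j∈
      ... | j∈T , j-near = x-far (∈-lastSub⁺ (+-cancelˡ-≤ m _ _ (begin
        m + suc n               ≡⟨ +-suc m n ⟩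
        suc m + n               ≤⟨ +-monoˡ-≤ n (∈-lastSub⁻ j-near) ⟩
        toℕ j + suc ℓ + n       ≡⟨ shuffle (toℕ j) ℓ n ⟩
        toℕ j + n + suc ℓ       ≤⟨ +-monoˡ-≤ (suc ℓ) (T-farther j∈T) ⟩
        toℕ x + m + suc ℓ       ≡⟨ shuffle′ (toℕ x) m ℓ ⟩
        m + (toℕ x + suc ℓ)     ∎)))
        where
        open ≤-Reasoning
        shuffle : ∀ j ℓ n → j + suc ℓ + n ≡ j + n + suc ℓ
        shuffle = solve-∀
        shuffle′ : ∀ x m ℓ → x + m + suc ℓ ≡ m + (x + suc ℓ)
        shuffle′ = solve-∀

-- Extending a family to a larger grid

record Shift {n} (S : Subset (suc n)) (S′ : Subset n) : Set where
  field
    first       : Fin (suc n)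
    first∈      : first ∈ S
    first-least : ∀ {j} → j ∈ S → first Fin.≤ j
    next        : Fin n → Fin (suc n)
    next∈       : ∀ {ρ} → ρ ∈ S′ → next ρ ∈ S
    <next       : ∀ {ρ} → ρ ∈ S′ → toℕ ρ < toℕ (next ρ)
    next-least  : ∀ {ρ j} → ρ ∈ S′ → j ∈ S → toℕ ρ < toℕ j → next ρ Fin.≤ j
    inject₁∈    : ∀ {ρ} → ρ ∈ S′ → inject₁ ρ ∈ S
    next-onto   : ∀ {i} → i ∈ S → i ≢ first → ∃ λ ρ → ρ ∈ S′ × next ρ ≡ i

  next≤ : ∀ {ρ σ} → ρ ∈ S′ → σ ∈ S′ → toℕ ρ < toℕ σ → toℕ (next ρ) ≤ toℕ σ
  next≤ {ρ} {σ} ρ∈ σ∈ ρ<σ = ≤-trans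
    (next-least ρ∈ (inject₁∈ σ∈) (subst (toℕ ρ <_) (sym (Finₚ.toℕ-inject₁ σ)) ρ<σ))
    (≤-reflexive (Finₚ.toℕ-inject₁ σ))

  gaps-disjoint : ∀ {ρ σ r} → ρ ∈ S′ → σ ∈ S′ →
                  toℕ ρ < r → r ≤ toℕ (next ρ) → toℕ σ < r → r ≤ toℕ (next σ) → ρ ≡ σ
  gaps-disjoint {ρ} {σ} ρ∈ σ∈ ρ<r r≤ρ⁺ σ<r r≤σ⁺ with Finₚ.<-cmp ρ σ
  ... | tri< ρ<σ _ _ = contradiction (≤-trans r≤ρ⁺ (next≤ ρ∈ σ∈ ρ<σ)) (<⇒≱ σ<r)
  ... | tri≈ _ ρ≡σ _ = ρ≡σ
  ... | tri> _ _ σ<ρ = contradiction (≤-trans r≤σ⁺ (next≤ σ∈ ρ∈ σ<ρ)) (<⇒≱ ρ<r)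

  first-gap-disjoint : ∀ {ρ r} → ρ ∈ S′ → toℕ ρ < r → r ≤ toℕ first → ⊥
  first-gap-disjoint {ρ} ρ∈ ρ<r r≤first = <⇒≱ ρ<r (≤-trans r≤first
    (≤-trans (first-least (inject₁∈ ρ∈)) (≤-reflexive (Finₚ.toℕ-inject₁ ρ))))

module _ {n} {S : Subset (suc n)} {x} (x∈S : x ∈ S) (S≤x : ∀ {j} → j ∈ S → j Fin.≤ x) where

  private
    Above : Fin n → Fin (suc n) → Set
    Above ρ j = toℕ ρ < toℕ j × j ∈ S

    above? : ∀ ρ → Decidable (Above ρ)
    above? ρ j = toℕ ρ <? toℕ j ×-dec j ∈? S

    inject₁∈ : ∀ {ρ} → ρ ∈ init (S - x) → inject₁ ρ ∈ S
    inject₁∈ = p─q⊆p S _ ∘ ∈-init⁻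

    <x : ∀ {ρ} → ρ ∈ init (S - x) → toℕ ρ < toℕ x
    <x {ρ} ρ∈ = subst (_< toℕ x) (Finₚ.toℕ-inject₁ ρ)
      (≤∧≢⇒< (S≤x (inject₁∈ ρ∈)) (x∈p-y⇒x≢y (∈-init⁻ ρ∈) ∘ Finₚ.toℕ-injective))

    -- x is a junk value: next is only ever used on init (S - x), where the search succeeds
    next : Fin n → Fin (suc n)
    next ρ with Finₚ.any? (above? ρ)
    ... | yes ∃above = proj₁ (least (above? ρ) ∃above)
    ... | no _       = x

    next-spec : ∀ {ρ} → ρ ∈ init (S - x) → Above ρ (next ρ) × (∀ {j} → Above ρ j → next ρ Fin.≤ j)
    next-spec {ρ} ρ∈ with Finₚ.any? (above? ρ)
    ... | yes ∃above = proj₂ (least (above? ρ) ∃above)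
    ... | no ∄above  = contradiction (x , <x ρ∈ , x∈S) ∄above

    minimum : ∃ λ i → i ∈ S × (∀ {j} → j ∈ S → i Fin.≤ j)
    minimum = least (_∈? S) (x , x∈S)
    first : Fin (suc n)
    first = proj₁ minimum
    first∈ : first ∈ S
    first∈ = proj₁ (proj₂ minimum)
    first-least : ∀ {j} → j ∈ S → first Fin.≤ j
    first-least = proj₂ (proj₂ minimum)

    first< : ∀ {i} → i ∈ S → i ≢ first → toℕ first < toℕ i
    first< i∈ i≢first = ≤∧≢⇒< (first-least i∈) (i≢first ∘ sym ∘ Finₚ.toℕ-injective)

    Below : Fin (suc n) → Fin (suc n) → Set
    Below i j = toℕ j < toℕ i × j ∈ S

    below? : ∀ i → Decidable (Below i)
    below? i j = toℕ j <? toℕ i ×-dec j ∈? S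

    next-onto : ∀ {i} → i ∈ S → i ≢ first → ∃ λ ρ → ρ ∈ init (S - x) × next ρ ≡ i
    next-onto {i} i∈ i≢first with greatest (below? i) (first , first< i∈ i≢first , first∈)
    ... | ρ₀ , (ρ₀<i , ρ₀∈) , ρ₀-greatest = ρ , ρ∈ , next≡i
      where
      n≢ρ₀ : n ≢ toℕ ρ₀
      n≢ρ₀ n≡ρ₀ = <⇒≱ ρ₀<i (subst (toℕ i ≤_) n≡ρ₀ (Finₚ.toℕ≤pred[n] i))
      ρ : Fin n
      ρ = lower₁ ρ₀ n≢ρ₀
      ρ≡ρ₀ : toℕ ρ ≡ toℕ ρ₀
      ρ≡ρ₀ = Finₚ.toℕ-lower₁ ρ₀ n≢ρ₀
      ρ∈ : ρ ∈ init (S - x)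
      ρ∈ = ∈-init⁺ (subst (_∈ S - x) (sym (Finₚ.inject₁-lower₁ ρ₀ n≢ρ₀))
             (x∈p∧x≢y⇒x∈p-y ρ₀∈ λ ρ₀≡x → <⇒≱ ρ₀<i (subst (λ t → i Fin.≤ t) (sym ρ₀≡x) (S≤x i∈))))
      next≡i : next ρ ≡ i
      next≡i with next-spec ρ∈
      ... | (ρ<next , next∈) , next-least = Finₚ.≤-antisym
        (next-least (subst (_< toℕ i) (sym ρ≡ρ₀) ρ₀<i , i∈))
        (≮⇒≥ λ next<i → <⇒≱ (subst (_< toℕ (next ρ)) ρ≡ρ₀ ρ<next) (ρ₀-greatest (next<i , next∈)))

  shift : Shift S (init (S - x))
  shift = record
    { first       = first
    ; first∈      = first∈
    ; first-least = first-least
    ; next        = next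
    ; next∈       = λ ρ∈ → proj₂ (proj₁ (next-spec ρ∈))
    ; <next       = λ ρ∈ → proj₁ (proj₁ (next-spec ρ∈))
    ; next-least  = λ ρ∈ j∈ ρ<j → proj₂ (next-spec ρ∈) (ρ<j , j∈)
    ; inject₁∈    = inject₁∈
    ; next-onto   = next-onto
    }

module OuterLift {p q k} {R : Subset (suc p)} {C : Subset (suc q)} {R′ : Subset p}
                 (sh : Shift R R′) (last∉C : fromℕ q ∉ C)
                 (L : Linkage p q (start {k}) (R′ , init C)) where
  open Shift sh
  open Linkage L

  descent : Label p q → List Step
  descent (inj₁ ρ) = east ∷ replicate (toℕ (next ρ) ∸ suc (toℕ ρ)) south
  descent (inj₂ γ) = []

  lift : Label p q → Label (suc p) (suc q)
  lift (inj₁ ρ) = inj₁ (next ρ)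
  lift (inj₂ γ) = inj₂ (inject₁ γ)

  steps⁺ : Fin (suc k) → List Step
  steps⁺ zero    = replicate q east ++ replicate (toℕ first) south
  steps⁺ (suc a) = steps a ++ descent (label a)

  label⁺ : Fin (suc k) → Label (suc p) (suc q)
  label⁺ zero    = inj₁ first
  label⁺ (suc a) = lift (label a)

  Rim : Point → Set
  Rim y = OnRow 0 0 q y ⊎ OnColumn q 0 (toℕ first) y

  rim : ∀ {y} → y ∈ₗ points (0 , 0) (steps⁺ zero) → Rim y
  rim y∈ with ∈-points-++⁻ (0 , 0) (replicate q east) (replicate (toℕ first) south) y∈
  ... | inj₁ y∈top  = inj₁ (∈-points-east⁻ 0 0 q y∈top)
  ... | inj₂ y∈side rewrite endpoint-east 0 0 q = inj₂ (∈-points-south⁻ 0 q (toℕ first) y∈side)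

  rim-end : endpoint (0 , 0) (steps⁺ zero) ≡ (toℕ first , q)
  rim-end = begin
    endpoint (0 , 0) (replicate q east ++ replicate (toℕ first) south)
      ≡⟨ endpoint-++ (0 , 0) (replicate q east) _ ⟩
    endpoint (endpoint (0 , 0) (replicate q east)) (replicate (toℕ first) south)
      ≡⟨ cong (λ e → endpoint e (replicate (toℕ first) south)) (endpoint-east 0 0 q) ⟩
    endpoint (0 , q) (replicate (toℕ first) south)
      ≡⟨ endpoint-south 0 q (toℕ first) ⟩
    (toℕ first , q)
      ∎
    where open ≡-Reasoning

  DescentPoint : Label p q → Point → Set
  DescentPoint l y = ∃ λ ρ → l ≡ inj₁ ρ × OnColumn q (suc (toℕ ρ)) (toℕ (next ρ)) y

  descent-points : ∀ {e} l → l ∈L (R′ , init C) → ValidLabel p q e l →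
                   ∀ {y} → y ∈ₗ points (down e) (descent l) → y ≡ down e ⊎ DescentPoint l y
  descent-points (inj₂ γ) _ _ (here y≡) = inj₁ y≡
  descent-points (inj₁ ρ) _ _ (here y≡) = inj₁ y≡
  descent-points {r , c} (inj₁ ρ) ρ∈ (ρ≡r , c+1≡q) {y} (there y∈)
    with ∈-points-south⁻ (suc r) (suc c) (toℕ (next ρ) ∸ suc (toℕ ρ)) y∈
  ... | on-column , below , above = inj₂ (ρ , refl , trans on-column c+1≡q ,
    subst (λ t → suc t ≤ proj₁ y) (sym ρ≡r) below ,
    ≤-trans above (≤-reflexive (trans (cong (λ t → suc t + _) (sym ρ≡r)) (m+[n∸m]≡n (<next ρ∈)))))

  descent-end : ∀ {e} l → l ∈L (R′ , init C) → ValidLabel p q e l →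
                ValidLabel (suc p) (suc q) (endpoint (down e) (descent l)) (lift l)
  descent-end {r , c} (inj₂ γ) _ (γ≡c , r+1≡p) =
    trans (Finₚ.toℕ-inject₁ γ) γ≡c , cong suc r+1≡p
  descent-end {r , c} (inj₁ ρ) ρ∈ (ρ≡r , c+1≡q)
    rewrite endpoint-south (suc r) (suc c) (toℕ (next ρ) ∸ suc (toℕ ρ)) =
      sym (trans (cong (λ t → suc t + _) (sym ρ≡r)) (m+[n∸m]≡n (<next ρ∈))) , cong suc c+1≡q

  data Trace (a : Fin k) (y : Point) : Set where
    shifted    : ∀ {z} → z ∈ₗ points (start a) (steps a) → y ≡ down z → Trace a y
    descending : DescentPoint (label a) y → Trace a y

  trace : ∀ a {y} → y ∈ₗ points (start (suc a)) (steps⁺ (suc a)) → Trace a y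
  trace a y∈ with ∈-points-++⁻ (down (start a)) (steps a) (descent (label a)) y∈
  ... | inj₁ y∈path with ∈-points-translate⁻ (1 , 0) (start a) (steps a) y∈path
  ...   | z , z∈ , y≡ = shifted z∈ y≡
  trace a y∈ | inj₂ y∈descent
    with descent-points (label a) (label∈ a) (labelled a)
           (subst (λ e → _ ∈ₗ points e (descent (label a)))
                  (endpoint-translate (1 , 0) (start a) (steps a)) y∈descent)
  ... | inj₁ y≡ = shifted (endpoint∈points (start a) (steps a)) y≡
  ... | inj₂ d  = descending d

  inGrid⁺ : ∀ a → All (InGrid (suc p) (suc q)) (points (start a) (steps⁺ a))
  inGrid⁺ zero    = All.tabulate (rim-inGrid ∘ rim)
    where
    rim-inGrid : ∀ {y} → Rim y → InGrid (suc p) (suc q) y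
    rim-inGrid (inj₁ (row≡0 , _ , col≤q)) =
      subst (_< suc p) (sym row≡0) (s≤s z≤n) , s≤s col≤q
    rim-inGrid (inj₂ (col≡q , _ , row≤first)) =
      ≤-<-trans row≤first (Finₚ.toℕ<n first) , s≤s (≤-reflexive col≡q)
  inGrid⁺ (suc a) = All.tabulate (trace-inGrid ∘ trace a)
    where
    trace-inGrid : ∀ {y} → Trace a y → InGrid (suc p) (suc q) y
    trace-inGrid (shifted z∈ refl) with inGrid-at z∈
    ... | r<p , c<q = s≤s r<p , m<n⇒m<1+n c<q
    trace-inGrid (descending (ρ , _ , col≡q , _ , row≤next)) =
      ≤-<-trans row≤next (Finₚ.toℕ<n (next ρ)) , s≤s (≤-reflexive col≡q)

  labelled⁺ : ∀ a → ValidLabel (suc p) (suc q) (endpoint (start a) (steps⁺ a)) (label⁺ a)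
  labelled⁺ zero    rewrite rim-end = refl , refl
  labelled⁺ (suc a) rewrite endpoint-++ (down (start a)) (steps a) (descent (label a))
                          | endpoint-translate (1 , 0) (start a) (steps a) =
    descent-end (label a) (label∈ a) (labelled a)

  rim-trace-disjoint : ∀ {b y} → Rim y → Trace b y → ⊥
  rim-trace-disjoint (inj₁ (() , _)) (shifted _ refl)
  rim-trace-disjoint (inj₁ (row≡0 , _)) (descending (_ , _ , _ , ρ<row , _)) =
    contradiction row≡0 (>⇒≢ (≤-trans (s≤s z≤n) ρ<row))
  rim-trace-disjoint (inj₂ (col≡q , _)) (shifted z∈ refl) = <⇒≢ (proj₂ (inGrid-at z∈)) col≡q
  rim-trace-disjoint (inj₂ (_ , _ , row≤first)) (descending (_ , lb≡ρ , _ , ρ<row , _)) =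
    first-gap-disjoint (label≡⇒∈ lb≡ρ) ρ<row row≤first

  trace-disjoint : ∀ {a b y} → a ≢ b → Trace a y → Trace b y → ⊥
  trace-disjoint {b = b} a≢b (shifted z∈ refl) (shifted z′∈ y≡) =
    disjoint a≢b z∈ (subst (_∈ₗ points (start b) (steps b)) (sym (translate-injective (1 , 0) y≡)) z′∈)
  trace-disjoint _ (shifted z∈ refl) (descending (_ , _ , col≡q , _)) =
    <⇒≢ (proj₂ (inGrid-at z∈)) col≡q
  trace-disjoint _ (descending (_ , _ , col≡q , _)) (shifted z∈ refl) =
    <⇒≢ (proj₂ (inGrid-at z∈)) col≡q
  trace-disjoint a≢b (descending (ρ , la≡ρ , _ , ρ<row , row≤ρ⁺))
                     (descending (σ , lb≡σ , _ , σ<row , row≤σ⁺)) =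
    distinct-labels a≢b (trans la≡ρ (trans (cong inj₁ ρ≡σ) (sym lb≡σ)))
    where
    ρ≡σ : ρ ≡ σ
    ρ≡σ = gaps-disjoint (label≡⇒∈ la≡ρ) (label≡⇒∈ lb≡σ) ρ<row row≤ρ⁺ σ<row row≤σ⁺

  disjoint⁺ : ∀ {a b} → a ≢ b → ∀ {y} →
              y ∈ₗ points (start a) (steps⁺ a) → y ∈ₗ points (start b) (steps⁺ b) → ⊥
  disjoint⁺ {zero}  {zero}  0≢0 _   _   = 0≢0 refl
  disjoint⁺ {zero}  {suc b} _   y∈a y∈b = rim-trace-disjoint (rim y∈a) (trace b y∈b)
  disjoint⁺ {suc a} {zero}  _   y∈a y∈b = rim-trace-disjoint (rim y∈b) (trace a y∈a)
  disjoint⁺ {suc a} {suc b} a≢b y∈a y∈b = trace-disjoint (a≢b ∘ cong suc) (trace a y∈a) (trace b y∈b)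

  lift-∈ : ∀ l → l ∈L (R′ , init C) → lift l ∈L (R , C)
  lift-∈ (inj₁ ρ) ρ∈ = next∈ ρ∈
  lift-∈ (inj₂ γ) γ∈ = ∈-init⁻ γ∈

  label⁺∈ : ∀ a → label⁺ a ∈L (R , C)
  label⁺∈ zero    = first∈
  label⁺∈ (suc a) = lift-∈ (label a) (label∈ a)

  realised : ∀ x → x ∈L (R , C) → ∃ λ a → label⁺ a ≡ x
  realised (inj₁ i) i∈ with i Finₚ.≟ first
  ... | yes refl = zero , refl
  ... | no i≢first with next-onto i∈ i≢first
  ...   | ρ , ρ∈ , refl with Equivalence.to (endpoints (inj₁ ρ)) ρ∈
  ...     | a , la≡ρ = suc a , cong lift la≡ρ
  realised (inj₂ j) j∈ with ∈⇒∈-init j∈ last∉C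
  ... | γ , γ∈ , refl with Equivalence.to (endpoints (inj₂ γ)) γ∈
  ...   | a , la≡γ = suc a , cong lift la≡γ

  outer : Linkage (suc p) (suc q) (start {suc k}) (R , C)
  outer = record
    { steps     = steps⁺
    ; label     = label⁺
    ; inGrid    = inGrid⁺
    ; labelled  = labelled⁺
    ; disjoint  = disjoint⁺
    ; endpoints = λ x → mk⇔ (realised x) (λ (a , a↦x) → subst (_∈L (R , C)) a↦x (label⁺∈ a))
    }

module InnerLift {p q k} (k≤p : k ≤ p) {R : Subset (suc p)} {C : Subset (suc q)} {C′ : Subset q}
                 (sh : Shift C C′) (last∉R : fromℕ p ∉ R)
                 (L : Linkage p q (start {k}) (init R , C′)) where
  open Shift sh
  open Linkage L

  origin : Maybe (Fin k) → Point
  origin = maybe′ start (k , 0)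

  traverse : Label p q → List Step
  traverse (inj₁ ρ) = []
  traverse (inj₂ γ) = south ∷ replicate (toℕ (next γ) ∸ suc (toℕ γ)) east

  lift : Label p q → Label (suc p) (suc q)
  lift (inj₁ ρ) = inj₁ (inject₁ ρ)
  lift (inj₂ γ) = inj₂ (next γ)

  steps⁺ : Maybe (Fin k) → List Step
  steps⁺ nothing  = replicate (p ∸ k) south ++ replicate (toℕ first) east
  steps⁺ (just a) = east ∷ (steps a ++ traverse (label a))

  label⁺ : Maybe (Fin k) → Label (suc p) (suc q)
  label⁺ nothing  = inj₂ first
  label⁺ (just a) = lift (label a)

  Rim : Point → Set
  Rim y = OnColumn 0 k p y ⊎ OnRow p 0 (toℕ first) y

  k+[p∸k]≡p : k + (p ∸ k) ≡ p
  k+[p∸k]≡p = m+[n∸m]≡n k≤p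

  rim : ∀ {y} → y ∈ₗ points (k , 0) (steps⁺ nothing) → Rim y
  rim y∈ with ∈-points-++⁻ (k , 0) (replicate (p ∸ k) south) (replicate (toℕ first) east) y∈
  ... | inj₁ y∈side with ∈-points-south⁻ k 0 (p ∸ k) y∈side
  ...   | col≡0 , k≤row , row≤ = inj₁ (col≡0 , k≤row , subst (_ ≤_) k+[p∸k]≡p row≤)
  rim y∈ | inj₂ y∈bottom rewrite endpoint-south k 0 (p ∸ k) | k+[p∸k]≡p =
    inj₂ (∈-points-east⁻ p 0 (toℕ first) y∈bottom)

  rim-end : endpoint (k , 0) (steps⁺ nothing) ≡ (p , toℕ first)
  rim-end = begin
    endpoint (k , 0) (replicate (p ∸ k) south ++ replicate (toℕ first) east)
      ≡⟨ endpoint-++ (k , 0) (replicate (p ∸ k) south) _ ⟩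
    endpoint (endpoint (k , 0) (replicate (p ∸ k) south)) (replicate (toℕ first) east)
      ≡⟨ cong (λ e → endpoint e (replicate (toℕ first) east)) side-end ⟩
    endpoint (p , 0) (replicate (toℕ first) east)
      ≡⟨ endpoint-east p 0 (toℕ first) ⟩
    (p , toℕ first)
      ∎
    where
    open ≡-Reasoning
    side-end : endpoint (k , 0) (replicate (p ∸ k) south) ≡ (p , 0)
    side-end = trans (endpoint-south k 0 (p ∸ k)) (cong (_, 0) k+[p∸k]≡p)

  TraversePoint : Label p q → Point → Set
  TraversePoint l y = ∃ λ γ → l ≡ inj₂ γ × OnRow p (suc (toℕ γ)) (toℕ (next γ)) y

  traverse-points : ∀ {e} l → l ∈L (init R , C′) → ValidLabel p q e l →
                    ∀ {y} → y ∈ₗ points (right e) (traverse l) → y ≡ right e ⊎ TraversePoint l y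
  traverse-points (inj₁ ρ) _ _ (here y≡) = inj₁ y≡
  traverse-points (inj₂ γ) _ _ (here y≡) = inj₁ y≡
  traverse-points {r , c} (inj₂ γ) γ∈ (γ≡c , r+1≡p) {y} (there y∈)
    with ∈-points-east⁻ (suc r) (suc c) (toℕ (next γ) ∸ suc (toℕ γ)) y∈
  ... | on-row , left , right-bound = inj₂ (γ , refl , trans on-row r+1≡p ,
    subst (λ t → suc t ≤ proj₂ y) (sym γ≡c) left ,
    ≤-trans right-bound (≤-reflexive (trans (cong (λ t → suc t + _) (sym γ≡c)) (m+[n∸m]≡n (<next γ∈)))))

  traverse-end : ∀ {e} l → l ∈L (init R , C′) → ValidLabel p q e l →
                 ValidLabel (suc p) (suc q) (endpoint (right e) (traverse l)) (lift l)
  traverse-end {r , c} (inj₁ ρ) _ (ρ≡r , c+1≡q) =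
    trans (Finₚ.toℕ-inject₁ ρ) ρ≡r , cong suc c+1≡q
  traverse-end {r , c} (inj₂ γ) γ∈ (γ≡c , r+1≡p)
    rewrite endpoint-east (suc r) (suc c) (toℕ (next γ) ∸ suc (toℕ γ)) =
      sym (trans (cong (λ t → suc t + _) (sym γ≡c)) (m+[n∸m]≡n (<next γ∈))) , cong suc r+1≡p

  data Trace (a : Fin k) (y : Point) : Set where
    at-origin  : y ≡ start a → Trace a y
    shifted    : ∀ {z} → z ∈ₗ points (start a) (steps a) → y ≡ right z → Trace a y
    traversing : TraversePoint (label a) y → Trace a y

  trace : ∀ a {y} → y ∈ₗ points (start a) (steps⁺ (just a)) → Trace a y
  trace a (here y≡) = at-origin y≡
  trace a (there y∈) with ∈-points-++⁻ (right (start a)) (steps a) (traverse (label a)) y∈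
  ... | inj₁ y∈path with ∈-points-translate⁻ (0 , 1) (start a) (steps a) y∈path
  ...   | z , z∈ , y≡ = shifted z∈ y≡
  trace a (there y∈) | inj₂ y∈traverse
    with traverse-points (label a) (label∈ a) (labelled a)
           (subst (λ e → _ ∈ₗ points e (traverse (label a)))
                  (endpoint-translate (0 , 1) (start a) (steps a)) y∈traverse)
  ... | inj₁ y≡ = shifted (endpoint∈points (start a) (steps a)) y≡
  ... | inj₂ t  = traversing t

  inGrid⁺ : ∀ a → All (InGrid (suc p) (suc q)) (points (origin a) (steps⁺ a))
  inGrid⁺ nothing  = All.tabulate (rim-inGrid ∘ rim)
    where
    rim-inGrid : ∀ {y} → Rim y → InGrid (suc p) (suc q) y
    rim-inGrid (inj₁ (col≡0 , _ , row≤p)) =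
      s≤s row≤p , subst (_< suc q) (sym col≡0) (s≤s z≤n)
    rim-inGrid (inj₂ (row≡p , _ , col≤first)) =
      s≤s (≤-reflexive row≡p) , ≤-<-trans col≤first (Finₚ.toℕ<n first)
  inGrid⁺ (just a) = All.tabulate (trace-inGrid ∘ trace a)
    where
    trace-inGrid : ∀ {y} → Trace a y → InGrid (suc p) (suc q) y
    trace-inGrid (at-origin refl) = m<n⇒m<1+n (<-≤-trans (Finₚ.toℕ<n a) k≤p) , s≤s z≤n
    trace-inGrid (shifted z∈ refl) with inGrid-at z∈
    ... | r<p , c<q = m<n⇒m<1+n r<p , s≤s c<q
    trace-inGrid (traversing (γ , _ , row≡p , _ , col≤next)) =
      s≤s (≤-reflexive row≡p) , ≤-<-trans col≤next (Finₚ.toℕ<n (next γ))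

  labelled⁺ : ∀ a → ValidLabel (suc p) (suc q) (endpoint (origin a) (steps⁺ a)) (label⁺ a)
  labelled⁺ nothing  rewrite rim-end = refl , refl
  labelled⁺ (just a) rewrite endpoint-++ (right (start a)) (steps a) (traverse (label a))
                           | endpoint-translate (0 , 1) (start a) (steps a) =
    traverse-end (label a) (label∈ a) (labelled a)

  rim-trace-disjoint : ∀ {b y} → Rim y → Trace b y → ⊥
  rim-trace-disjoint {b} (inj₁ (_ , k≤row , _)) (at-origin refl) = <⇒≱ (Finₚ.toℕ<n b) k≤row
  rim-trace-disjoint (inj₁ (() , _)) (shifted _ refl)
  rim-trace-disjoint (inj₁ (col≡0 , _)) (traversing (_ , _ , _ , γ<col , _)) =
    contradiction col≡0 (>⇒≢ (≤-trans (s≤s z≤n) γ<col))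
  rim-trace-disjoint {b} (inj₂ (p≡b , _)) (at-origin refl) = <⇒≢ (<-≤-trans (Finₚ.toℕ<n b) k≤p) p≡b
  rim-trace-disjoint (inj₂ (row≡p , _)) (shifted z∈ refl) = <⇒≢ (proj₁ (inGrid-at z∈)) row≡p
  rim-trace-disjoint (inj₂ (_ , _ , col≤first)) (traversing (_ , lb≡γ , _ , γ<col , _)) =
    first-gap-disjoint (label≡⇒∈ lb≡γ) γ<col col≤first

  trace-disjoint : ∀ {a b y} → a ≢ b → Trace a y → Trace b y → ⊥
  trace-disjoint a≢b (at-origin refl) (at-origin a≡b) = a≢b (Finₚ.toℕ-injective (cong proj₁ a≡b))
  trace-disjoint _ (at-origin refl) (shifted _ ())
  trace-disjoint _ (at-origin refl) (traversing (_ , _ , _ , γ<0 , _)) = contradiction γ<0 λ ()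
  trace-disjoint _ (shifted _ refl) (at-origin ())
  trace-disjoint {b = b} a≢b (shifted z∈ refl) (shifted z′∈ y≡) =
    disjoint a≢b z∈ (subst (_∈ₗ points (start b) (steps b)) (sym (translate-injective (0 , 1) y≡)) z′∈)
  trace-disjoint _ (shifted z∈ refl) (traversing (_ , _ , row≡p , _)) =
    <⇒≢ (proj₁ (inGrid-at z∈)) row≡p
  trace-disjoint _ (traversing (_ , _ , _ , γ<0 , _)) (at-origin refl) = contradiction γ<0 λ ()
  trace-disjoint _ (traversing (_ , _ , row≡p , _)) (shifted z∈ refl) =
    <⇒≢ (proj₁ (inGrid-at z∈)) row≡p
  trace-disjoint a≢b (traversing (γ , la≡γ , _ , γ<col , col≤γ⁺))
                     (traversing (δ , lb≡δ , _ , δ<col , col≤δ⁺)) =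
    distinct-labels a≢b (trans la≡γ (trans (cong inj₂ γ≡δ) (sym lb≡δ)))
    where
    γ≡δ : γ ≡ δ
    γ≡δ = gaps-disjoint (label≡⇒∈ la≡γ) (label≡⇒∈ lb≡δ) γ<col col≤γ⁺ δ<col col≤δ⁺

  disjoint⁺ : ∀ {a b} → a ≢ b → ∀ {y} →
              y ∈ₗ points (origin a) (steps⁺ a) → y ∈ₗ points (origin b) (steps⁺ b) → ⊥
  disjoint⁺ {nothing} {nothing} n≢n _   _   = n≢n refl
  disjoint⁺ {nothing} {just b}  _   y∈a y∈b = rim-trace-disjoint (rim y∈a) (trace b y∈b)
  disjoint⁺ {just a}  {nothing} _   y∈a y∈b = rim-trace-disjoint (rim y∈b) (trace a y∈a)
  disjoint⁺ {just a}  {just b}  a≢b y∈a y∈b = trace-disjoint (a≢b ∘ cong just) (trace a y∈a) (trace b y∈b)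

  lift-∈ : ∀ l → l ∈L (init R , C′) → lift l ∈L (R , C)
  lift-∈ (inj₁ ρ) ρ∈ = ∈-init⁻ ρ∈
  lift-∈ (inj₂ γ) γ∈ = next∈ γ∈

  label⁺∈ : ∀ a → label⁺ a ∈L (R , C)
  label⁺∈ nothing  = first∈
  label⁺∈ (just a) = lift-∈ (label a) (label∈ a)

  realised : ∀ x → x ∈L (R , C) → ∃ λ a → label⁺ a ≡ x
  realised (inj₂ j) j∈ with j Finₚ.≟ first
  ... | yes refl = nothing , refl
  ... | no j≢first with next-onto j∈ j≢first
  ...   | γ , γ∈ , refl with Equivalence.to (endpoints (inj₂ γ)) γ∈
  ...     | a , la≡γ = just a , cong lift la≡γ
  realised (inj₁ i) i∈ with ∈⇒∈-init i∈ last∉R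
  ... | ρ , ρ∈ , refl with Equivalence.to (endpoints (inj₁ ρ)) ρ∈
  ...   | a , la≡ρ = just a , cong lift la≡ρ

  start-origin : ∀ a → start (maybe′ inject₁ (fromℕ k) a) ≡ origin a
  start-origin nothing  = cong (_, 0) (Finₚ.toℕ-fromℕ k)
  start-origin (just a) = cong (_, 0) (Finₚ.toℕ-inject₁ a)

  inner : Linkage (suc p) (suc q) (start {suc k}) (R , C)
  inner = reindex (Maybe↔Fin k) start-origin (record
    { steps     = steps⁺
    ; label     = label⁺
    ; inGrid    = inGrid⁺
    ; labelled  = labelled⁺
    ; disjoint  = disjoint⁺
    ; endpoints = λ x → mk⇔ (realised x) (λ (a , a↦x) → subst (_∈L (R , C)) a↦x (label⁺∈ a))
    })

-- Sufficiency of the hook condition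

∉-card≡0 : ∀ {p q} {E : LSubset p q} x → card E ≡ 0 → ¬ x ∈L E
∉-card≡0 {E = R , C} (inj₁ i) ∣R∣+∣C∣≡0 i∈ = >⇒≢ (x∈p⇒0<∣p∣ i∈) (m+n≡0⇒m≡0 ∣ R ∣ ∣R∣+∣C∣≡0)
∉-card≡0 {E = R , C} (inj₂ j) ∣R∣+∣C∣≡0 j∈ = >⇒≢ (x∈p⇒0<∣p∣ j∈) (m+n≡0⇒n≡0 ∣ R ∣ ∣R∣+∣C∣≡0)

no-paths : ∀ {p q} {E : LSubset p q} → card E ≡ 0 → Linkage p q (start {0}) E
no-paths card≡0 = record
  { steps     = λ ()
  ; label     = λ ()
  ; inGrid    = λ ()
  ; labelled  = λ ()
  ; disjoint  = λ {a} → contradiction a λ ()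
  ; endpoints = λ x → mk⇔ (λ x∈ → contradiction x∈ (∉-card≡0 x card≡0)) λ ()
  }

sufficient : ∀ k {p q} → k ≤ p → k ≤ q → (E : LSubset p q) → card E ≡ k → HookCondition k E →
             Linkage p q (start {k}) E
sufficient zero _ _ _ card≡0 _ = no-paths card≡0
sufficient (suc k) {suc p} {suc q} (s≤s k≤p) (s≤s k≤q) E@(R , C) card≡ hook with cornermost R C card≡
... | inj₁ (x , cm) = OuterLift.outer (shift x∈S S≤x) last∉C
        (sufficient k k≤p k≤q (peel x E) (card-peel last∉C card≡) (hook-peel hook))
  where
  open Cornermost cm
  open Peel cm
  last∉C : fromℕ q ∉ C
  last∉C = last∉T (hook 1 ≤-refl (s≤s z≤n))
... | inj₂ (x , cm) = InnerLift.inner k≤p (shift x∈S S≤x) last∉R (sufficient k k≤p k≤q E′ card′ hook′)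
  where
  open Cornermost cm
  open Peel cm
  last∉R : fromℕ p ∉ R
  last∉R = last∉T (hook-swap E hook 1 ≤-refl (s≤s z≤n))
  E′ : LSubset p q
  E′ = swap (peel x (swap E))
  card′ : card E′ ≡ k
  card′ = trans (card-swap (peel x (swap E))) (card-peel last∉R (trans (card-swap E) card≡))
  hook′ : HookCondition k E′
  hook′ = hook-swap (peel x (swap E)) (hook-peel (hook-swap E hook))

lemma3p1 : (p q k : ℕ) → k ≤ p → k ≤ q → (E : LSubset p q) → card E ≡ k →
    InEndpointSets p q k E ⇔ ((ℓ : ℕ) → 1 ≤ ℓ → ℓ ≤ k → card (Esub ℓ E) ≤ ℓ)
lemma3p1 p q k k≤p k≤q E card≡k = mk⇔
  (λ E∈𝓔 ℓ _ ℓ≤k → Necessity.necessary k≤p k≤q (toLinkage E∈𝓔) ℓ≤k)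
  (λ hook → fromLinkage (sufficient k k≤p k≤q E card≡k hook))
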